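{- Fix $k\in\mathbb{N}$ and consider the multi-story Riviera (OR) model with at most $k$ stories. Then every word $w\in\{0,\dots,k\}^{4k+1}$ that occurs as a contiguous subword of some maximal configuration (of arbitrary length) also occurs as a contiguous subword of some maximal configuration of length $8k+1$. Moreover, if $w$ occurs as a prefix (respectively suffix) of some maximal configuration, then there is a maximal configuration of length $8k+1$ having $w$ as a prefix (respectively suffix).
   Context: Multi-story Riviera (OR) model with maximal number $k$ of stories: a configuration of length $n$ is $C=(c_1,\dots,c_n)\in\{0,1,\dots,k\}^n$, $c_i$ being the number of stories of the house on lot $i$ of a $1\times n$ strip ($c_i=0$: empty lot); set $c_j=0$ for $j\notin\{1,\dots,n\}$. A house with $c_i$ stories on lot $i$ blocks sunlight (from its side) to each lot $j$ with $1\le|i-j|\le c_i$ up to height $c_i-|i-j|+1$ stories: story $h$ ($1\le h\le c_j$) of the house on lot $j$ is blocked from the west if there is $i<j$ with $h\le c_i-(j-i)+1$, and blocked from the east if there is $i>j$ with $h\le c_i-(i-j)+1$. $C$ is permissible if no story of any house is blocked both from the east and from the west. $C$ is maximal if it is permissible and for every $i$ with $c_i<k$, increasing $c_i$ by one yields a non-permissible configuration. -}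

module Defs where

open import Data.Nat using (ℕ; zero; suc; _+_; _*_; _≤_; _<_)
open import Data.List using (List; []; _∷_; _++_; length)
open import Data.List.Relation.Unary.All using (All)
open import Data.Product using (_×_; ∃; ∃-syntax)
open import Relation.Nullary using (¬_)
open import Relation.Binary.PropositionalEquality using (_≡_)

-- A configuration is a list (c_0, …, c_{n-1}) of story counts (lots indexed
-- from 0 instead of 1).  `at C j` is c_j, with c_j = 0 outside the strip.
at : List ℕ → ℕ → ℕ
at []       _       = 0
at (c ∷ cs) zero    = c
at (c ∷ cs) (suc j) = at cs j

incAt : List ℕ → ℕ → List ℕ
incAt []       _       = []
incAt (c ∷ cs) zero    = suc c ∷ cs
incAt (c ∷ cs) (suc i) = c ∷ incAt cs i

-- story h of lot j is blocked from the west: some i < j with h ≤ c_i - (j - i) + 1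
-- (written without truncated subtraction: h + (j - i) ≤ c_i + 1, with j = i + d)
BlockedW : List ℕ → ℕ → ℕ → Set
BlockedW C j h = ∃[ i ] ∃[ d ] (1 ≤ d × i + d ≡ j × h + d ≤ at C i + 1)

BlockedE : List ℕ → ℕ → ℕ → Set
BlockedE C j h = ∃[ i ] ∃[ d ] (1 ≤ d × j + d ≡ i × h + d ≤ at C i + 1)

Permissible : List ℕ → Set
Permissible C = ∀ j h → 1 ≤ h → h ≤ at C j → ¬ (BlockedW C j h × BlockedE C j h)

Maximal : ℕ → List ℕ → Set
Maximal k C =
  All (_≤ k) C × Permissible C ×
  (∀ i → i < length C → at C i < k → ¬ Permissible (incAt C i))

Infix : List ℕ → List ℕ → Set
Infix w C = ∃[ u ] ∃[ v ] (C ≡ u ++ (w ++ v))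

Prefix : List ℕ → List ℕ → Set
Prefix w C = ∃[ v ] (C ≡ w ++ v)

Suffix : List ℕ → List ℕ → Set
Suffix w C = ∃[ u ] (C ≡ u ++ w)

{-# OPTIONS --safe #-}
-- A failure of permissibility is a story blocked from both sides, and such a
-- witness already shows on the ground floor.  In a configuration bounded by k
-- a blocker reaches at most k lots, so if raising lot i of a permissible
-- configuration destroys permissibility, the witness lies within distance 2k
-- of i.  Cut out of a maximal configuration C a window of length 8k+1 that
-- contains the 2k-neighbourhood of every lot of w (padding C with empty lots
-- where the window sticks out), and complete the window greedily to a maximal
-- configuration D of the same length.  Every lot of w is saturated in C, hence
-- in the window, hence it is never raised: D still contains w.

module Submission where

open import Defs
open import Data.Nat
open import Data.Nat.Properties
open import Data.Nat.Induction using (<-wellFounded)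
open import Algebra.Properties.CommutativeSemigroup +-commutativeSemigroup using (x∙yz≈y∙xz)
open import Data.Nat.Tactic.RingSolver using (solve-∀)
open import Data.List using (List; []; _∷_; _++_; length; replicate; applyUpTo)
open import Data.List.Properties using (length-++; length-applyUpTo; ++-identityʳ)
open import Data.List.Relation.Unary.All using (All; []; _∷_)
open import Data.List.Relation.Unary.All.Properties using (++⁺; replicate⁺; applyUpTo⁺₂)
open import Data.Product using (∃; ∃-syntax; _×_; _,_; proj₁; proj₂)
open import Function using (_∘_; case_of_)
open import Induction.WellFounded using (Acc; acc)
open import Relation.Nullary using (¬_; Dec; yes; no; contradiction)
open import Relation.Nullary.Decidable using (_×-dec_; ¬?; map′; decidable-stable)
open import Relation.Binary.PropositionalEquality

at-≤ : ∀ {k} C → All (_≤ k) C → ∀ x → at C x ≤ k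
at-≤ []      _         x       = z≤n
at-≤ (c ∷ C) (c≤k ∷ _) zero    = c≤k
at-≤ (c ∷ C) (_ ∷ C≤k) (suc x) = at-≤ C C≤k x

at-occupied⇒< : ∀ C x → 1 ≤ at C x → x < length C
at-occupied⇒< (c ∷ C) zero    _  = z<s
at-occupied⇒< (c ∷ C) (suc x) 1≤ = s<s (at-occupied⇒< C x 1≤)

at-++ʳ : ∀ u C x → at (u ++ C) (length u + x) ≡ at C x
at-++ʳ []      C x = refl
at-++ʳ (c ∷ u) C x = at-++ʳ u C x

at-++ˡ : ∀ w v {m} → m < length w → at (w ++ v) m ≡ at w m
at-++ˡ (c ∷ w) v {zero}  _         = refl
at-++ˡ (c ∷ w) v {suc m} (s≤s m<) = at-++ˡ w v m<

at-replicate-++ : ∀ a C x → at (replicate a 0 ++ C) (a + x) ≡ at C x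
at-replicate-++ zero    C x = refl
at-replicate-++ (suc a) C x = at-replicate-++ a C x

at-replicate-++-occupied : ∀ a C z → 1 ≤ at (replicate a 0 ++ C) z → a ≤ z
at-replicate-++-occupied zero    C z       _  = z≤n
at-replicate-++-occupied (suc a) C (suc z) 1≤ = s≤s (at-replicate-++-occupied a C z 1≤)

at-applyUpTo : ∀ g n {y} → y < n → at (applyUpTo g n) y ≡ g y
at-applyUpTo g (suc n) {zero}  _        = refl
at-applyUpTo g (suc n) {suc y} (s≤s y<) = at-applyUpTo (g ∘ suc) n y<

at-applyUpTo-≤ : ∀ g n y → at (applyUpTo g n) y ≤ g y
at-applyUpTo-≤ g zero    y       = z≤n
at-applyUpTo-≤ g (suc n) zero    = ≤-refl
at-applyUpTo-≤ g (suc n) (suc y) = at-applyUpTo-≤ (g ∘ suc) n y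

length-incAt : ∀ C i → length (incAt C i) ≡ length C
length-incAt []      i       = refl
length-incAt (c ∷ C) zero    = refl
length-incAt (c ∷ C) (suc i) = cong suc (length-incAt C i)

at-incAt-≡ : ∀ C {i} → i < length C → at (incAt C i) i ≡ suc (at C i)
at-incAt-≡ (c ∷ C) {zero}  _        = refl
at-incAt-≡ (c ∷ C) {suc i} (s≤s i<) = at-incAt-≡ C i<

at-incAt-≢ : ∀ C {i x} → x ≢ i → at (incAt C i) x ≡ at C x
at-incAt-≢ []      {i}     {x}     _   = refl
at-incAt-≢ (c ∷ C) {zero}  {zero}  x≢i = contradiction refl x≢i
at-incAt-≢ (c ∷ C) {zero}  {suc x} _   = refl
at-incAt-≢ (c ∷ C) {suc i} {zero}  _   = refl
at-incAt-≢ (c ∷ C) {suc i} {suc x} x≢i = at-incAt-≢ C (x≢i ∘ cong suc)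

incAt-bounded : ∀ {k} C i → at C i < k → All (_≤ k) C → All (_≤ k) (incAt C i)
incAt-bounded []      i       _   []          = []
incAt-bounded (c ∷ C) zero    c<k (_ ∷ C≤k)   = c<k ∷ C≤k
incAt-bounded (c ∷ C) (suc i) <k  (c≤k ∷ C≤k) = c≤k ∷ incAt-bounded C i <k C≤k

infix 4 _≼_

_≼_ : List ℕ → List ℕ → Set
X ≼ Y = ∀ x → at X x ≤ at Y x

≼-incAt : ∀ C i → C ≼ incAt C i
≼-incAt []      i       x       = ≤-refl
≼-incAt (c ∷ C) zero    zero    = n≤1+n c
≼-incAt (c ∷ C) zero    (suc x) = ≤-refl
≼-incAt (c ∷ C) (suc i) zero    = ≤-refl
≼-incAt (c ∷ C) (suc i) (suc x) = ≼-incAt C i x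

incAt-≼ : ∀ X Y q → X ≼ Y → at X q < at Y q → incAt X q ≼ Y
incAt-≼ []      Y       q       X≼Y _  x       = z≤n
incAt-≼ (c ∷ X) []      zero    _   () _
incAt-≼ (c ∷ X) []      (suc q) _   () _
incAt-≼ (c ∷ X) (d ∷ Y) zero    X≼Y lt zero    = lt
incAt-≼ (c ∷ X) (d ∷ Y) zero    X≼Y lt (suc x) = X≼Y (suc x)
incAt-≼ (c ∷ X) (d ∷ Y) (suc q) X≼Y lt zero    = X≼Y zero
incAt-≼ (c ∷ X) (d ∷ Y) (suc q) X≼Y lt (suc x) = incAt-≼ X Y q (X≼Y ∘ suc) lt x

-- Conflicts

-- Lot west + dʷ is occupied and its ground floor is blocked by lot west from
-- the west and by lot west + dʷ + dᵉ from the east.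
record Conflict (f : ℕ → ℕ) : Set where
  constructor conflict
  field
    west dʷ dᵉ : ℕ
    1≤dʷ       : 1 ≤ dʷ
    1≤dᵉ       : 1 ≤ dᵉ
    dʷ≤west    : dʷ ≤ f west
    1≤mid      : 1 ≤ f (west + dʷ)
    dᵉ≤east    : dᵉ ≤ f (west + dʷ + dᵉ)

  east : ℕ
  east = west + dʷ + dᵉ

open Conflict

west≤east : ∀ {f} (c : Conflict f) → west c ≤ east c
west≤east c = ≤-trans (m≤m+n (west c) (dʷ c)) (m≤m+n _ (dᵉ c))

permissible⇒conflict-free : ∀ C → Permissible C → ¬ Conflict (at C)
permissible⇒conflict-free C perm (conflict i d e 1≤d 1≤e d≤ 1≤mid e≤) =
  perm (i + d) 1 ≤-refl 1≤mid
    ((i , d , 1≤d , refl , ground d≤) , (i + d + e , e , 1≤e , refl , ground e≤))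
  where
  ground : ∀ {d c} → d ≤ c → 1 + d ≤ c + 1
  ground {d} {c} d≤c = ≤-trans (s≤s d≤c) (≤-reflexive (+-comm 1 c))

conflict-free⇒permissible : ∀ C → ¬ Conflict (at C) → Permissible C
conflict-free⇒permissible C free .(i + d) h 1≤h h≤
  ((i , d , 1≤d , refl , hw) , (.(i + d + e) , e , 1≤e , refl , he)) =
  free (conflict i d e 1≤d 1≤e (lower hw) (≤-trans 1≤h h≤) (lower he))
  where
  lower : ∀ {d c} → h + d ≤ c + 1 → d ≤ c
  lower {d} {c} le =
    ≤-pred (≤-trans (+-monoˡ-≤ d 1≤h) (≤-trans le (≤-reflexive (+-comm c 1))))

conflict-translate : ∀ {f g} a s (c : Conflict f) → s ≤ a + west c →
  (∀ {x y} → a + x ≡ s + y → west c ≤ x → x ≤ east c → f x ≤ g y) → Conflict g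
conflict-translate a s c@(conflict i d e 1≤d 1≤e d≤ 1≤mid e≤) s≤ f≤g =
  conflict y d e 1≤d 1≤e
    (≤-trans d≤ (f≤g i↦y ≤-refl (west≤east c)))
    (≤-trans 1≤mid (f≤g (shift d i↦y) (m≤m+n i d) (m≤m+n (i + d) e)))
    (≤-trans e≤ (f≤g (shift e (shift d i↦y)) (west≤east c) ≤-refl))
  where
  y = a + i ∸ s
  i↦y : a + i ≡ s + y
  i↦y = sym (m+[n∸m]≡n s≤)
  shift : ∀ {x z} t → a + x ≡ s + z → a + (x + t) ≡ s + (z + t)
  shift {x} {z} t eq = begin
    a + (x + t) ≡⟨ +-assoc a x t ⟨
    a + x + t   ≡⟨ cong (_+ t) eq ⟩
    s + z + t   ≡⟨ +-assoc s z t ⟩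
    s + (z + t) ∎
    where open ≡-Reasoning

conflict-mono : ∀ {f g} (c : Conflict f) →
  (∀ {x} → west c ≤ x → x ≤ east c → f x ≤ g x) → Conflict g
conflict-mono c f≤g = conflict-translate 0 0 c z≤n (λ { refl → f≤g })

permissible-antitone : ∀ X Y → X ≼ Y → Permissible Y → Permissible X
permissible-antitone X Y X≼Y perm = conflict-free⇒permissible X λ c →
  permissible⇒conflict-free Y perm (conflict-mono c (λ {x} _ _ → X≼Y x))

east<length : ∀ C (c : Conflict (at C)) → east c < length C
east<length C c = at-occupied⇒< C (east c) (≤-trans (1≤dᵉ c) (dᵉ≤east c))

conflict? : ∀ C → Dec (Conflict (at C))
conflict? C = map′ fromBounded toBounded
  (anyUpTo? (λ i → anyUpTo? (λ d → anyUpTo? (conflictAt? i d) n) n) n)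
  where
  n = length C
  f = at C
  ConflictAt : ℕ → ℕ → ℕ → Set
  ConflictAt i d e = 1 ≤ d × 1 ≤ e × d ≤ f i × 1 ≤ f (i + d) × e ≤ f (i + d + e)
  conflictAt? : ∀ i d e → Dec (ConflictAt i d e)
  conflictAt? i d e =
    1 ≤? d ×-dec 1 ≤? e ×-dec d ≤? f i ×-dec 1 ≤? f (i + d) ×-dec e ≤? f (i + d + e)
  Bounded : Set
  Bounded = ∃ λ i → i < n × ∃ λ d → d < n × ∃ λ e → e < n × ConflictAt i d e
  fromBounded : Bounded → Conflict f
  fromBounded (i , _ , d , _ , e , _ , 1≤d , 1≤e , d≤ , 1≤mid , e≤) =
    conflict i d e 1≤d 1≤e d≤ 1≤mid e≤
  toBounded : Conflict f → Bounded
  toBounded c@(conflict i d e 1≤d 1≤e d≤ 1≤mid e≤) =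
    i , ≤-<-trans (west≤east c) east<n ,
    d , ≤-<-trans (≤-trans (m≤n+m d i) (m≤m+n (i + d) e)) east<n ,
    e , ≤-<-trans (m≤n+m e (i + d)) east<n ,
    1≤d , 1≤e , d≤ , 1≤mid , e≤
    where east<n = east<length C c

permissible? : ∀ C → Dec (Permissible C)
permissible? C =
  map′ (conflict-free⇒permissible C) (permissible⇒conflict-free C) (¬? (conflict? C))

-- Greedy completion to a maximal configuration

deficit : ℕ → List ℕ → ℕ
deficit k []      = 0
deficit k (c ∷ C) = k ∸ c + deficit k C

deficit-incAt : ∀ k C {i} → i < length C → at C i < k → deficit k (incAt C i) < deficit k C
deficit-incAt k (c ∷ C) {zero}  _        c<k =
  +-monoˡ-< (deficit k C) (∸-monoʳ-< (n<1+n c) c<k)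
deficit-incAt k (c ∷ C) {suc i} (s≤s i<) <k  =
  +-monoʳ-< (k ∸ c) (deficit-incAt k C i< <k)

maximal-extension : ∀ k X → All (_≤ k) X → Permissible X →
  ∃[ D ] (length D ≡ length X × Maximal k D × X ≼ D)
maximal-extension k X = extend X (<-wellFounded (deficit k X))
  where
  extend : ∀ X → Acc _<_ (deficit k X) → All (_≤ k) X → Permissible X →
    ∃[ D ] (length D ≡ length X × Maximal k D × X ≼ D)
  extend X (acc rec) X≤k perm
    with anyUpTo? (λ i → at X i <? k ×-dec permissible? (incAt X i)) (length X)
  ... | no saturated =
    X , refl , (X≤k , perm , λ i i< c<k perm⁺ → saturated (i , i< , c<k , perm⁺)) ,
    λ _ → ≤-refl
  ... | yes (i , i< , c<k , perm⁺)
    with extend (incAt X i) (rec (deficit-incAt k X i< c<k)) (incAt-bounded X i c<k X≤k) perm⁺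
  ... | D , lenD , maxD , X⁺≼D =
    D , trans lenD (length-incAt X i) , maxD , λ x → ≤-trans (≼-incAt X i x) (X⁺≼D x)

raise-conflict-near : ∀ {k} C i → Permissible C → All (_≤ k) (incAt C i) →
  (c : Conflict (at (incAt C i))) → i ≤ west c + (k + k) × east c ≤ i + (k + k)
raise-conflict-near {k} C i perm C⁺≤k c@(conflict w d e _ _ d≤ _ e≤) =
  ≤-trans i≤east (≤-trans (≤-reflexive (+-assoc w d e)) (+-monoʳ-≤ w d+e≤k+k)) ,
  ≤-trans (≤-reflexive (+-assoc w d e)) (+-mono-≤ west≤i d+e≤k+k)
  where
  d+e≤k+k : d + e ≤ k + k
  d+e≤k+k = +-mono-≤ (≤-trans d≤ (at-≤ _ C⁺≤k w)) (≤-trans e≤ (at-≤ _ C⁺≤k (w + d + e)))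
  -- a conflict avoiding lot i is already a conflict of C
  misses-i : ¬ (∀ {x} → w ≤ x → x ≤ east c → x ≢ i)
  misses-i x≢i = permissible⇒conflict-free C perm
    (conflict-mono c (λ w≤x x≤e → ≤-reflexive (at-incAt-≢ C (x≢i w≤x x≤e))))
  west≤i : w ≤ i
  west≤i = decidable-stable (w ≤? i) λ w≰i →
    misses-i (λ w≤x _ x≡i → w≰i (subst (w ≤_) x≡i w≤x))
  i≤east : i ≤ east c
  i≤east = decidable-stable (i ≤? east c) λ i≰e →
    misses-i (λ _ x≤e x≡i → i≰e (subst (_≤ east c) x≡i x≤e))

-- Windows

-- The strip is extended by a empty lots on the west; lot x of C becomes lot y
-- of the window when a + x ≡ s + y.
window : (a s N : ℕ) → List ℕ → List ℕ
window a s N C = applyUpTo (λ y → at (replicate a 0 ++ C) (s + y)) N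

length-window : ∀ a s N C → length (window a s N C) ≡ N
length-window a s N C = length-applyUpTo _ N

translate-< : ∀ {a s N x y} → a + x ≡ s + y → a + x < s + N → y < N
translate-< {a} {s} {N} {x} {y} x↦y x< = +-cancelˡ-< s y N (subst (_< s + N) x↦y x<)

at-window : ∀ a s N C {x y} → a + x ≡ s + y → y < N → at (window a s N C) y ≡ at C x
at-window a s N C {x} {y} x↦y y<N = begin
  at (window a s N C) y           ≡⟨ at-applyUpTo _ N y<N ⟩
  at (replicate a 0 ++ C) (s + y) ≡⟨ cong (at (replicate a 0 ++ C)) x↦y ⟨
  at (replicate a 0 ++ C) (a + x) ≡⟨ at-replicate-++ a C x ⟩
  at C x                          ∎
  where open ≡-Reasoning

window-bounded : ∀ {k} a s N C → All (_≤ k) C → All (_≤ k) (window a s N C)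
window-bounded a s N C C≤k =
  applyUpTo⁺₂ _ N (λ y → at-≤ _ (++⁺ (replicate⁺ a z≤n) C≤k) (s + y))

window-permissible : ∀ a s N C → Permissible C → Permissible (window a s N C)
window-permissible a s N C perm = conflict-free⇒permissible W λ c →
  permissible⇒conflict-free C perm
    (conflict-translate s a c (padding≤ c) (λ y↦x _ _ → W≤C y↦x))
  where
  W = window a s N C
  P = replicate a 0 ++ C
  W≤P : ∀ y → at W y ≤ at P (s + y)
  W≤P y = at-applyUpTo-≤ _ N y
  W≤C : ∀ {y x} → s + y ≡ a + x → at W y ≤ at C x
  W≤C {y} {x} y↦x =
    ≤-trans (W≤P y) (≤-reflexive (trans (cong (at P) y↦x) (at-replicate-++ a C x)))
  padding≤ : (c : Conflict (at W)) → a ≤ s + west c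
  padding≤ c = at-replicate-++-occupied a C _
    (≤-trans (1≤dʷ c) (≤-trans (dʷ≤west c) (W≤P (west c))))

at-incAt-window : ∀ a s N C {i q x y} → i < length C → q < N → a + i ≡ s + q →
  a + x ≡ s + y → y < N → at (incAt C i) x ≡ at (incAt (window a s N C) q) y
at-incAt-window a s N C {i} {q} {x} {y} i< q<N i↦q x↦y y<N with x ≟ i
... | yes refl = begin
  at (incAt C x) x ≡⟨ at-incAt-≡ C i< ⟩
  suc (at C x)     ≡⟨ cong suc (at-window a s N C i↦q q<N) ⟨
  suc (at W q)     ≡⟨ at-incAt-≡ W (subst (q <_) (sym (length-window a s N C)) q<N) ⟨
  at (incAt W q) q ≡⟨ cong (at (incAt W q)) (+-cancelˡ-≡ s y q (trans (sym x↦y) i↦q)) ⟨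
  at (incAt W q) y ∎
  where
  W = window a s N C
  open ≡-Reasoning
... | no x≢i =
  trans (at-incAt-≢ C x≢i)
    (trans (sym (at-window a s N C x↦y y<N)) (sym (at-incAt-≢ (window a s N C) y≢q)))
  where
  y≢q : y ≢ q
  y≢q refl = x≢i (+-cancelˡ-≡ a x i (trans x↦y (sym i↦q)))

Covers : (k a s N : ℕ) → List ℕ → ℕ → Set
Covers k a s N C i =
  ∀ {x} → x < length C → i ≤ x + (k + k) → x ≤ i + (k + k) →
  s ≤ a + x × a + x < s + N

covered-lot-< : ∀ {k a s N C i q} →
  i < length C → a + i ≡ s + q → Covers k a s N C i → q < N
covered-lot-< {k} {a} {s} {i = i} i< i↦q covers =
  translate-< {a} {s} i↦q (proj₂ (covers i< (m≤m+n i (k + k)) (m≤m+n i (k + k))))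

raise-window-permissible : ∀ {k a s N} C {i q} → Permissible C → All (_≤ k) (incAt C i) →
  i < length C → a + i ≡ s + q → Covers k a s N C i →
  Permissible (incAt (window a s N C) q) → Permissible (incAt C i)
raise-window-permissible {k} {a} {s} {N} C {i} {q} perm C⁺≤k i< i↦q covers perm⁺ =
  conflict-free⇒permissible (incAt C i) λ c →
    permissible⇒conflict-free (incAt (window a s N C) q) perm⁺
      (conflict-translate a s c (proj₁ (inside c ≤-refl (west≤east c)))
      (λ x↦y w≤x x≤e → ≤-reflexive (at-incAt-window a s N C i< q<N i↦q x↦y
        (translate-< {a} {s} x↦y (proj₂ (inside c w≤x x≤e))))))
  where
  q<N : q < N
  q<N = covered-lot-< {k} {C = C} i< i↦q covers
  inside : (c : Conflict (at (incAt C i))) →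
    ∀ {x} → west c ≤ x → x ≤ east c → s ≤ a + x × a + x < s + N
  inside c w≤x x≤e = covers
    (≤-<-trans x≤e (subst (east c <_) (length-incAt C i) (east<length (incAt C i) c)))
    (≤-trans (proj₁ near) (+-monoˡ-≤ (k + k) w≤x))
    (≤-trans x≤e (proj₂ near))
    where near = raise-conflict-near C i perm C⁺≤k c

maximal-window : ∀ {k C} → Maximal k C → ∀ a s N →
  ∃[ D ] (length D ≡ N × Maximal k D ×
          (∀ {i q} → i < length C → a + i ≡ s + q → Covers k a s N C i →
             at D q ≡ at C i))
maximal-window {k} {C} (C≤k , perm , saturated) a s N
  with maximal-extension k (window a s N C)
         (window-bounded a s N C C≤k) (window-permissible a s N C perm)
... | D , lenD , maxD@(D≤k , permD , _) , W≼D =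
  D , trans lenD (length-window a s N C) , maxD , kept
  where
  W = window a s N C
  kept : ∀ {i q} → i < length C → a + i ≡ s + q → Covers k a s N C i → at D q ≡ at C i
  kept {i} {q} i< i↦q covers = trans (≤-antisym (≮⇒≥ raised) (W≼D q)) W≡C
    where
    W≡C : at W q ≡ at C i
    W≡C = at-window a s N C i↦q (covered-lot-< {k} {C = C} i< i↦q covers)
    -- D dominates the window raised at q, so that raise is permissible, hence so
    -- is raising i in C, against the maximality of C.
    raised : ¬ at W q < at D q
    raised W<D = saturated i i< C<k
      (raise-window-permissible {k} {a} {s} {N} C perm (incAt-bounded C i C<k C≤k) i< i↦q covers
        (permissible-antitone (incAt W q) D (incAt-≼ W D q W≼D W<D) permD))
      where
      C<k : at C i < k
      C<k = <-≤-trans (subst (_< at D q) W≡C W<D) (at-≤ D D≤k q)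

agreement⇒infix : ∀ o w D → o + length w ≤ length D →
  (∀ {m} → m < length w → at D (o + m) ≡ at w m) →
  ∃[ u ] ∃[ v ] (length u ≡ o × D ≡ u ++ w ++ v)
agreement⇒infix zero [] D _ _ = [] , D , refl , refl
agreement⇒infix zero (x ∷ w) (y ∷ D) (s≤s fits) agree
  with agree z<s | agreement⇒infix zero w D fits (λ m< → agree (s<s m<))
... | refl | [] , v , _ , refl = [] , v , refl , refl
agreement⇒infix (suc o) w (y ∷ D) (s≤s fits) agree with agreement⇒infix o w D fits agree
... | u , v , refl , refl = y ∷ u , v , refl , refl

transplant : ∀ {k} u w v → Maximal k (u ++ w ++ v) → ∀ a N →
  (∀ {m} → m < length w → Covers k a (length u) N (u ++ w ++ v) (length u + m)) →
  a + length w ≤ N →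
  ∃[ D ] (length D ≡ N × Maximal k D ×
          ∃[ u′ ] ∃[ v′ ] (length u′ ≡ a × D ≡ u′ ++ w ++ v′))
transplant u w v maxC a N covers fits =
  D , lenD , maxD , agreement⇒infix a w D (subst (a + length w ≤_) (sym lenD) fits) agree
  where
  p = length u
  completion = maximal-window maxC a p N
  D = proj₁ completion
  lenD = proj₁ (proj₂ completion)
  maxD = proj₁ (proj₂ (proj₂ completion))
  kept = proj₂ (proj₂ (proj₂ completion))
  agree : ∀ {m} → m < length w → at D (a + m) ≡ at w m
  agree {m} m< = begin
    at D (a + m)             ≡⟨ kept lot< (x∙yz≈y∙xz a p m) (covers m<) ⟩
    at (u ++ w ++ v) (p + m) ≡⟨ at-++ʳ u (w ++ v) m ⟩
    at (w ++ v) m            ≡⟨ at-++ˡ w v m< ⟩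
    at w m                   ∎
    where
    open ≡-Reasoning
    lot< : p + m < length (u ++ w ++ v)
    lot< = subst (p + m <_) (sym (trans (length-++ u) (cong (p +_) (length-++ w))))
      (+-monoʳ-< p (<-≤-trans m< (m≤m+n (length w) (length v))))

full-infix⇒suffix : ∀ (u w v : List ℕ) →
  length (u ++ w ++ v) ≡ length u + length w → u ++ w ++ v ≡ u ++ w
full-infix⇒suffix (x ∷ u) w       v  eq = cong (x ∷_) (full-infix⇒suffix u w v (suc-injective eq))
full-infix⇒suffix []      (x ∷ w) v  eq = cong (x ∷_) (full-infix⇒suffix [] w v (suc-injective eq))
full-infix⇒suffix []      []      [] _  = refl

≤⇒<+1 : ∀ {x} p n → x ≤ p + n → x < p + (n + 1)
≤⇒<+1 {x} p n x≤ = subst (x <_) (+-assoc p n 1) (≤-<-trans x≤ (m<m+n (p + n) z<s))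

infix-span : ∀ k p → k + k + (p + 4 * k + (k + k)) ≡ p + 8 * k
infix-span = solve-∀

halves-8k+1 : ∀ k → 4 * k + (4 * k + 1) ≡ 8 * k + 1
halves-8k+1 = solve-∀

k+k≤4k : ∀ k → k + k ≤ 4 * k
k+k≤4k k = ≤-trans (m≤m+n (k + k) (k + k)) (≤-reflexive (double k))
  where
  double : ∀ k → k + k + (k + k) ≡ 4 * k
  double = solve-∀

suffix-span : ∀ k p → 4 * k + (p + 4 * k) ≡ p + 8 * k
suffix-span = solve-∀

prefix-span : ∀ k → 4 * k + 4 * k ≡ 8 * k
prefix-span = solve-∀

module _ (k : ℕ) (w : List ℕ) (len-w : length w ≡ 4 * k + 1) where

  private
    m≤4k : ∀ {m} → m < length w → m ≤ 4 * k
    m≤4k {m} m< = ≤-pred (subst (m <_) (trans len-w (+-comm (4 * k) 1)) m<)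

    window-fits : ∀ a → a ≤ 4 * k → a + length w ≤ 8 * k + 1
    window-fits a a≤4k = begin
      a + length w         ≡⟨ cong (a +_) len-w ⟩
      a + (4 * k + 1)      ≤⟨ +-monoˡ-≤ (4 * k + 1) a≤4k ⟩
      4 * k + (4 * k + 1)  ≡⟨ halves-8k+1 k ⟩
      8 * k + 1            ∎
      where open ≤-Reasoning

  shorten-infix : ∃[ C ] (Maximal k C × Infix w C) →
    ∃[ C ] (length C ≡ 8 * k + 1 × Maximal k C × Infix w C)
  shorten-infix (.(u ++ w ++ v) , maxC , u , v , refl) =
    let (D , lenD , maxD , u′ , v′ , _ , D≡) =
          transplant u w v maxC (k + k) (8 * k + 1) covers (window-fits (k + k) (k+k≤4k k))
    in D , lenD , maxD , u′ , v′ , D≡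
    where
    p = length u
    covers : ∀ {m} → m < length w → Covers k (k + k) p (8 * k + 1) (u ++ w ++ v) (p + m)
    covers {m} m< {x} _ i≤ x≤ =
      ≤-trans (m≤m+n p m) (≤-trans i≤ (≤-reflexive (+-comm x (k + k)))) ,
      ≤⇒<+1 p (8 * k) (begin
        k + k + x                     ≤⟨ +-monoʳ-≤ (k + k) x≤ ⟩
        k + k + (p + m + (k + k))
          ≤⟨ +-monoʳ-≤ (k + k) (+-monoˡ-≤ (k + k) (+-monoʳ-≤ p (m≤4k m<))) ⟩
        k + k + (p + 4 * k + (k + k)) ≡⟨ infix-span k p ⟩
        p + 8 * k                     ∎)
      where open ≤-Reasoning

  shorten-prefix : ∃[ C ] (Maximal k C × Prefix w C) →
    ∃[ C ] (length C ≡ 8 * k + 1 × Maximal k C × Prefix w C)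
  shorten-prefix (.(w ++ v) , maxC , v , refl) =
    case transplant [] w v maxC 0 (8 * k + 1) covers (window-fits 0 z≤n) of λ where
      (D , lenD , maxD , [] , v′ , _ , D≡) → D , lenD , maxD , v′ , D≡
      (_ , _ , _ , _ ∷ _ , _ , () , _)
    where
    covers : ∀ {m} → m < length w → Covers k 0 0 (8 * k + 1) (w ++ v) m
    covers {m} m< {x} _ _ x≤ = z≤n , ≤⇒<+1 0 (8 * k) (begin
      x               ≤⟨ x≤ ⟩
      m + (k + k)     ≤⟨ +-mono-≤ (m≤4k m<) (k+k≤4k k) ⟩
      4 * k + 4 * k   ≡⟨ prefix-span k ⟩
      8 * k           ∎)
      where open ≤-Reasoning

  shorten-suffix : ∃[ C ] (Maximal k C × Suffix w C) →
    ∃[ C ] (length C ≡ 8 * k + 1 × Maximal k C × Suffix w C)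
  shorten-suffix (.(u ++ w) , maxC , u , refl) =
    let (D , lenD , maxD , u′ , v′ , len-u′ , D≡) =
          transplant u w [] (subst (Maximal k) (sym u++w++[]) maxC) (4 * k) (8 * k + 1)
            covers (window-fits (4 * k) ≤-refl)
    in D , lenD , maxD , u′ , trans D≡ (full-infix⇒suffix u′ w v′ (begin
         length (u′ ++ w ++ v′)  ≡⟨ cong length D≡ ⟨
         length D                ≡⟨ lenD ⟩
         8 * k + 1               ≡⟨ halves-8k+1 k ⟨
         4 * k + (4 * k + 1)     ≡⟨ cong₂ _+_ len-u′ len-w ⟨
         length u′ + length w    ∎))
    where
    open ≡-Reasoning
    p = length u
    u++w++[] : u ++ w ++ [] ≡ u ++ w
    u++w++[] = cong (u ++_) (++-identityʳ w)
    length-C : length (u ++ w ++ []) ≡ suc (p + 4 * k)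
    length-C = begin
      length (u ++ w ++ [])  ≡⟨ cong length u++w++[] ⟩
      length (u ++ w)        ≡⟨ length-++ u ⟩
      p + length w           ≡⟨ cong (p +_) len-w ⟩
      p + (4 * k + 1)        ≡⟨ +-assoc p (4 * k) 1 ⟨
      p + 4 * k + 1          ≡⟨ +-comm (p + 4 * k) 1 ⟩
      suc (p + 4 * k)        ∎
    covers : ∀ {m} → m < length w → Covers k (4 * k) p (8 * k + 1) (u ++ w ++ []) (p + m)
    covers {m} m< {x} x< i≤ _ =
      ≤-trans (m≤m+n p m)
        (≤-trans i≤ (≤-trans (+-monoʳ-≤ x (k+k≤4k k)) (≤-reflexive (+-comm x (4 * k))))) ,
      ≤⇒<+1 p (8 * k) (≤-trans (+-monoʳ-≤ (4 * k) (≤-pred (subst (x <_) length-C x<)))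
        (≤-reflexive (suffix-span k p)))

lemma3p2 : (k : ℕ) (w : List ℕ) → length w ≡ 4 * k + 1 → All (_≤ k) w →
    ((∃[ C ] (Maximal k C × Infix w C)) →
       ∃[ C ] (length C ≡ 8 * k + 1 × Maximal k C × Infix w C))
    × ((∃[ C ] (Maximal k C × Prefix w C)) →
       ∃[ C ] (length C ≡ 8 * k + 1 × Maximal k C × Prefix w C))
    × ((∃[ C ] (Maximal k C × Suffix w C)) →
       ∃[ C ] (length C ≡ 8 * k + 1 × Maximal k C × Suffix w C))
lemma3p2 k w len-w _ = shorten-infix k w len-w , shorten-prefix k w len-w , shorten-suffix k w len-w
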